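{- Let $0\le i<j<n$ and let $F\subseteq E$. Then $F\in\mathcal{F}_{i,j}$ if and only if there exists $x$ with $i\le x<j$ such that exactly one of the following holds: (i) $F=\{(x,n)\}$; (ii) $F=\{(x,y)\}\cup F'$ for some edge $(x,y)\in E$ with $i\le x<j<y<n$ and some $F'\in\mathcal{F}_{j,y}$.
   Context: Let $n\ge 2$, $V=\{0,1,\dots,n\}$, and let $P$ be the path $0-1-\cdots-n$. Let $E$ be a finite multiset of edges on $V$ not belonging to $P$ (parallel edges allowed); each edge $ij\in E$ with $i<j$ is written as the ordered pair $(i,j)$. For $0\le i<j<n$, $\mathcal{F}_{i,j}$ denotes the family of all edge sets $F\subseteq E$ such that: (i) $F$ is an inclusion-minimal edge set such that $P\cup F$ contains $2$ internally node-disjoint $(j-1,n)$-paths; and (ii) every $(x,y)\in F$ satisfies $x\ge i$. -}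

module Defs where

open import Data.Nat using (ℕ; zero; suc; _≤_; _<_)
open import Data.Fin using (Fin)
open import Data.Fin.Subset using (Subset; inside; _⊆_; _∈_)
open import Data.Product using (_×_; _,_; proj₁; proj₂; ∃; Σ)
open import Data.Sum using (_⊎_)
open import Data.List using (List; []; _∷_)
open import Data.List.Membership.Propositional renaming (_∈_ to _∈ₗ_)
open import Data.List.Relation.Unary.Unique.Propositional using (Unique)
open import Relation.Binary.PropositionalEquality using (_≡_; _≢_)
open import Relation.Nullary using (¬_)

-- The extra edge multiset E on V = {0,…,n} is an indexed family of m
-- ordered pairs (a , b) with a < b; parallel edges = equal values at
-- different indices.  An edge (a , b) is a non-path edge of the graph
-- on {0..n}:  a + 1 < b  (so a < b and b ≠ a+1) and b ≤ n.
ValidEdges : ℕ → {m : ℕ} → (Fin m → ℕ × ℕ) → Set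
ValidEdges n E = ∀ e → suc (proj₁ (E e)) < proj₂ (E e) × proj₂ (E e) ≤ n

-- Edge identities in the multigraph P ∪ F: path edge k = {k, k+1}
-- (k < n), or the extra edge with index e.
data Label (m : ℕ) : Set where
  pathEdge  : ℕ → Label m
  extraEdge : Fin m → Label m

data Step (n : ℕ) {m : ℕ} (E : Fin m → ℕ × ℕ) (F : Subset m) : ℕ → ℕ → Set where
  fwdP : ∀ k → k < n → Step n E F k (suc k)
  bwdP : ∀ k → k < n → Step n E F (suc k) k
  fwdE : ∀ e → e ∈ F → Step n E F (proj₁ (E e)) (proj₂ (E e))
  bwdE : ∀ e → e ∈ F → Step n E F (proj₂ (E e)) (proj₁ (E e))

stepLabel : ∀ {n m E F u v} → Step n {m} E F u v → Label m
stepLabel (fwdP k _) = pathEdge k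
stepLabel (bwdP k _) = pathEdge k
stepLabel (fwdE e _) = extraEdge e
stepLabel (bwdE e _) = extraEdge e

data Walk (n : ℕ) {m : ℕ} (E : Fin m → ℕ × ℕ) (F : Subset m) : ℕ → ℕ → Set where
  []  : ∀ {u} → Walk n E F u u
  _∷_ : ∀ {u v w} → Step n E F u v → Walk n E F v w → Walk n E F u w

vertices : ∀ {n m E F u w} → Walk n {m} E F u w → List ℕ
vertices {u = u} []      = u ∷ []
vertices {u = u} (s ∷ p) = u ∷ vertices p

interior : ∀ {n m E F u w} → Walk n {m} E F u w → List ℕ
interior []      = []
interior (s ∷ p) = inner p
  where
  inner : ∀ {a b} → Walk _ _ _ a b → List ℕ
  inner []                = []
  inner {a = a} (t ∷ q)   = a ∷ inner q

labels : ∀ {n m E F u w} → Walk n {m} E F u w → List (Label m)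
labels []      = []
labels (s ∷ p) = stepLabel s ∷ labels p

IsPath : ∀ {n m E F u w} → Walk n {m} E F u w → Set
IsPath p = Unique (vertices p)

TwoDisjointPaths : (n : ℕ) {m : ℕ} (E : Fin m → ℕ × ℕ) (F : Subset m) → ℕ → ℕ → Set
TwoDisjointPaths n E F s t =
  Σ (Walk n E F s t) λ p → Σ (Walk n E F s t) λ q →
    IsPath p × IsPath q × labels p ≢ labels q ×
    (∀ v → v ∈ₗ interior p → ¬ (v ∈ₗ interior q))

InFam : (n : ℕ) {m : ℕ} (E : Fin m → ℕ × ℕ) → ℕ → ℕ → Subset m → Set
InFam n E i j F =
  (TwoDisjointPaths n E F (j Data.Nat.∸ 1) n ×
   (∀ G → G ⊆ F → TwoDisjointPaths n E G (j Data.Nat.∸ 1) n → G ≡ F))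
  × (∀ e → e ∈ F → i ≤ proj₁ (E e))

ExactlyOne : Set → Set → Set
ExactlyOne A B = (A ⊎ B) × ¬ (A × B)

-- Say that an extra edge (x , y) crosses a vertex z when x < z < y.  Two
-- internally disjoint (s , n)-paths exist in P ∪ G exactly when every
-- vertex z with s < z < n is crossed by an edge of G: an uncrossed z is a
-- cut vertex that every (s , n)-walk passes through, and conversely
-- repeatedly taking the crossing edge reaching furthest to the right gives
-- a chain of edges along which two routes to n can alternate.  So 𝓕_{i,j}
-- consists of the inclusion-minimal sets covering {j,…,n-1} whose edges
-- start at or after i.  Such a set contains the outermost edge e = (x , y)
-- crossing j; either y = n and e is the whole set, or the remaining edges
-- all start at or after j and form a minimal cover of {y,…,n-1}.

module Submission where

open import Defs
open import Data.Nat using (ℕ; suc; _≤_; _<_; _∸_; _≤ᵇ_; _≤‴_; _≤′_; ≤‴-reflexive; ≤‴-step; ≤′-reflexive; ≤′-step; z≤n; s≤s)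
open import Data.Nat.Properties
open import Data.Nat.Induction using (<-wellFounded)
open import Induction.WellFounded using (Acc; acc)
open import Data.Fin using (Fin)
open import Data.Fin.Properties using (any?)
open import Data.Fin.Subset using (Subset; ⁅_⁆; _∪_; _∩_; _⊆_; _∈_)
open import Data.Fin.Subset.Properties using (x∈⁅x⁆; x∈⁅y⁆⇒x≡y; ⊆-refl; ⊆-trans; ⊆-antisym; p∩q⊆p; p∩q⊆q; x∈p∩q⁺; x∈p∩q⁻; x∈p∪q⁺; x∈p∪q⁻; _∈?_)
open import Data.Vec using (tabulate)
open import Data.Vec.Properties using ([]=⇒lookup; lookup⇒[]=; lookup∘tabulate)
open import Data.Product using (_×_; _,_; proj₁; proj₂; ∃; Σ)
import Data.Product as Product
open import Data.Sum using (_⊎_; inj₁; inj₂; [_,_]′)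
import Data.Sum as Sum
open import Data.Empty using (⊥-elim)
open import Data.List using (_∷_; filter; allFin)
open import Data.List.Relation.Unary.Any using (here; there)
import Data.List.Relation.Unary.All as All
open import Data.List.Relation.Unary.All.Properties using (all-filter)
open import Data.List.Relation.Unary.AllPairs using ([]; _∷_)
open import Data.List.Membership.Propositional using () renaming (_∈_ to _∈ₗ_)
open import Data.List.Membership.Propositional.Properties using (∈-filter⁺; ∈-allFin)
open import Data.List.Extrema.Nat using (argmax; argmax-all; f[xs]≤f[argmax])
open import Relation.Binary.PropositionalEquality using (_≡_; _≢_; refl; sym; trans; cong; subst)
open import Relation.Binary.Definitions using (tri<; tri≈; tri>)
open import Relation.Nullary using (¬_; Dec; yes; no)
open import Relation.Nullary.Decidable using (_×-dec_)
open import Data.Bool.Properties using (T-≡)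
open import Function.Base using (_∘_)
open import Function.Bundles using (_⇔_; mk⇔; Equivalence)

module _ {n m : ℕ} {E : Fin m → ℕ × ℕ} {G : Subset m} where

  ascend-bound : ∀ {u t} → suc u ≤‴ t → t ≤ n → u < n
  ascend-bound u<t t≤n = <-≤-trans (≤‴⇒≤ u<t) t≤n

  ascend : ∀ {u t w} → u ≤‴ t → t ≤ n → Walk n E G t w → Walk n E G u w
  ascend (≤‴-reflexive refl) _   q = q
  ascend (≤‴-step u<t)       t≤n q = fwdP _ (ascend-bound u<t t≤n) ∷ ascend u<t t≤n q

  descend : ∀ {t u w} → t ≤′ u → u ≤ n → Walk n E G t w → Walk n E G u w
  descend (≤′-reflexive refl) _   q = q
  descend (≤′-step t≤u)       u≤n q = bwdP _ u≤n ∷ descend t≤u (<⇒≤ u≤n) q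

  ascend-vertices : ∀ {u t w x} (u≤t : u ≤‴ t) (t≤n : t ≤ n) (q : Walk n E G t w) →
                    x ∈ₗ vertices (ascend u≤t t≤n q) → (u ≤ x × x < t) ⊎ x ∈ₗ vertices q
  ascend-vertices (≤‴-reflexive refl) _   q x∈         = inj₂ x∈
  ascend-vertices (≤‴-step u<t)       _   q (here refl) = inj₁ (≤-refl , ≤‴⇒≤ u<t)
  ascend-vertices (≤‴-step u<t)       t≤n q (there x∈)  =
    Sum.map₁ (Product.map₁ <⇒≤) (ascend-vertices u<t t≤n q x∈)

  descend-vertices : ∀ {t u w x} (t≤u : t ≤′ u) (u≤n : u ≤ n) (q : Walk n E G t w) →
                     x ∈ₗ vertices (descend t≤u u≤n q) → (t < x × x ≤ u) ⊎ x ∈ₗ vertices q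
  descend-vertices (≤′-reflexive refl) _   q x∈         = inj₂ x∈
  descend-vertices (≤′-step t≤u)       _   q (here refl) = inj₁ (s≤s (≤′⇒≤ t≤u) , ≤-refl)
  descend-vertices (≤′-step t≤u)       u≤n q (there x∈)  =
    Sum.map₁ (Product.map₂ m≤n⇒m≤1+n) (descend-vertices t≤u (<⇒≤ u≤n) q x∈)

  step-isPath : ∀ {u a w} (s : Step n E G u a) {q : Walk n E G a w} →
                (∀ {x} → x ∈ₗ vertices q → u ≢ x) → IsPath q → IsPath (s ∷ q)
  step-isPath _ fresh q-path = All.tabulate fresh ∷ q-path

  ascend-isPath : ∀ {u t w} (u≤t : u ≤‴ t) (t≤n : t ≤ n) {q : Walk n E G t w} →
                  (∀ {x} → x ∈ₗ vertices q → t ≤ x) → IsPath q → IsPath (ascend u≤t t≤n q)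
  ascend-isPath (≤‴-reflexive refl) _ _ q-path = q-path
  ascend-isPath (≤‴-step u<t) t≤n {q} above q-path =
    step-isPath (fwdP _ (ascend-bound u<t t≤n)) fresh (ascend-isPath u<t t≤n above q-path)
    where
    fresh : ∀ {x} → x ∈ₗ vertices (ascend u<t t≤n q) → _ ≢ x
    fresh x∈ with ascend-vertices u<t t≤n q x∈
    ... | inj₁ (u<x , _) = <⇒≢ u<x
    ... | inj₂ x∈q       = <⇒≢ (<-≤-trans (≤‴⇒≤ u<t) (above x∈q))

  descend-isPath : ∀ {t u w} (t≤u : t ≤′ u) (u≤n : u ≤ n) {q : Walk n E G t w} →
                   (∀ {x} → x ∈ₗ vertices q → x ≤ t ⊎ u < x) → IsPath q → IsPath (descend t≤u u≤n q)
  descend-isPath (≤′-reflexive refl) _ _ q-path = q-path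
  descend-isPath {t} (≤′-step {c} t≤c) u≤n {q} outside q-path =
    step-isPath (bwdP c u≤n) fresh (descend-isPath t≤c (<⇒≤ u≤n) outside′ q-path)
    where
    outside′ : ∀ {x} → x ∈ₗ vertices q → x ≤ t ⊎ c < x
    outside′ x∈ = Sum.map₂ (<-trans (n<1+n c)) (outside x∈)
    fresh : ∀ {x} → x ∈ₗ vertices (descend t≤c (<⇒≤ u≤n) q) → suc c ≢ x
    fresh x∈ with descend-vertices t≤c (<⇒≤ u≤n) q x∈
    ... | inj₁ (_ , x≤c) = >⇒≢ (s≤s x≤c)
    ... | inj₂ x∈q with outside x∈q
    ...   | inj₁ x≤t  = >⇒≢ (s≤s (≤-trans x≤t (≤′⇒≤ t≤c)))
    ...   | inj₂ c<x  = <⇒≢ c<x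

  labels-descend-jump≢pathEdge : ∀ {u w e} (t≤u : proj₁ (E e) ≤′ u) (u≤n : u ≤ n) (e∈ : e ∈ G)
                                 (q : Walk n E G (proj₂ (E e)) w) →
                                 ∀ ls → labels (descend t≤u u≤n (fwdE e e∈ ∷ q)) ≢ pathEdge u ∷ ls
  labels-descend-jump≢pathEdge (≤′-reflexive refl) _ _ _ _ ()
  labels-descend-jump≢pathEdge (≤′-step _)         _ _ _ _ ()

  ∈-vertices-end : ∀ {u w} (p : Walk n E G u w) → w ∈ₗ vertices p
  ∈-vertices-end []      = here refl
  ∈-vertices-end (_ ∷ p) = there (∈-vertices-end p)

  interior⊆tail : ∀ {u a w x} (s : Step n E G u a) (q : Walk n E G a w) →
                  x ∈ₗ interior (s ∷ q) → x ∈ₗ vertices q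
  interior⊆tail _ (_ ∷ _) (here refl) = here refl
  interior⊆tail _ (t ∷ q) (there x∈)  = there (interior⊆tail t q x∈)

  interior⊆vertices : ∀ {u w x} (p : Walk n E G u w) → x ∈ₗ interior p → x ∈ₗ vertices p
  interior⊆vertices (s ∷ q) x∈ = there (interior⊆tail s q x∈)

  interior-≢-end : ∀ {u w x} (p : Walk n E G u w) → IsPath p → x ∈ₗ interior p → x ≢ w
  interior-≢-end (_ ∷ _ ∷ q) (_ ∷ a∉q ∷ _) (here refl) = All.lookup a∉q (∈-vertices-end q)
  interior-≢-end (_ ∷ t ∷ q) (_ ∷ t∷q-path) (there x∈) = interior-≢-end (t ∷ q) t∷q-path x∈

  interior-cons : ∀ {u a w x} (s : Step n E G u a) (q : Walk n E G a w) →
                  x ∈ₗ interior q → x ∈ₗ interior (s ∷ q)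
  interior-cons _ (_ ∷ _) x∈ = there x∈

  interior-head : ∀ {u a w} (s : Step n E G u a) (q : Walk n E G a w) → a ≢ w → a ∈ₗ interior (s ∷ q)
  interior-head _ []      a≢a = ⊥-elim (a≢a refl)
  interior-head _ (_ ∷ _) _   = here refl

module Covering (n : ℕ) {m : ℕ} (E : Fin m → ℕ × ℕ) (valid : ValidEdges n E) where

  X Y : Fin m → ℕ
  X e = proj₁ (E e)
  Y e = proj₂ (E e)

  X<Y : ∀ e → X e < Y e
  X<Y e = <-trans (n<1+n (X e)) (proj₁ (valid e))

  Y≤n : ∀ e → Y e ≤ n
  Y≤n e = proj₂ (valid e)

  Crosses : Fin m → ℕ → Set
  Crosses e z = X e < z × z < Y e

  CrossesIn : Subset m → ℕ → Fin m → Set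
  CrossesIn G z e = e ∈ G × Crosses e z

  Crossed : Subset m → ℕ → Set
  Crossed G z = ∃ (CrossesIn G z)

  Covers : Subset m → ℕ → Set
  Covers G j = ∀ {z} → j ≤ z → z < n → Crossed G z

  Outermost : Subset m → ℕ → Fin m → Set
  Outermost G z e = CrossesIn G z e × (∀ f → CrossesIn G z f → Y f ≤ Y e)

  crossesIn? : ∀ G z e → Dec (CrossesIn G z e)
  crossesIn? G z e = (e ∈? G) ×-dec ((X e <? z) ×-dec (z <? Y e))

  outermost : ∀ {G z} → Crossed G z → ∃ (Outermost G z)
  outermost {G} {z} (e₀ , e₀-crosses) =
    e , argmax-all Y e₀-crosses (all-filter (crossesIn? G z) (allFin m)) , maximal
    where
    candidates = filter (crossesIn? G z) (allFin m)
    e = argmax Y e₀ candidates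
    maximal : ∀ f → CrossesIn G z f → Y f ≤ Y e
    maximal f f-crosses =
      All.lookup (f[xs]≤f[argmax] e₀ candidates) (∈-filter⁺ (crossesIn? G z) (∈-allFin f) f-crosses)

  outermost-beyond : ∀ {G w e z f} → Outermost G w e → Y e ≤ z → CrossesIn G z f → w ≤ X f
  outermost-beyond ((_ , _ , w<Ye) , maximal) Ye≤z (f∈ , Xf<z , z<Yf) = ≮⇒≥ λ Xf<w →
    <⇒≱ (≤-<-trans Ye≤z z<Yf) (maximal _ (f∈ , Xf<w , <-trans w<Ye (≤-<-trans Ye≤z z<Yf)))

  module _ {G : Subset m} where

    step-across⇒crossed : ∀ {u a z} → Step n E G u a → u < z → z < a → Crossed G z
    step-across⇒crossed (fwdP k _)  k<z   z<1+k = ⊥-elim (<⇒≱ k<z (≤-pred z<1+k))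
    step-across⇒crossed (bwdP k _)  1+k<z z<k   = ⊥-elim (<-asym (<-trans (n<1+n k) 1+k<z) z<k)
    step-across⇒crossed (fwdE e e∈) x<z   z<y   = e , e∈ , x<z , z<y
    step-across⇒crossed (bwdE e e∈) y<z   z<x   = ⊥-elim (<-asym (<-trans (X<Y e) y<z) z<x)

    uncrossed∈interior : ∀ {u w z} (p : Walk n E G u w) → u < z → z < w → ¬ Crossed G z →
                         z ∈ₗ interior p
    uncrossed∈interior [] u<z z<u _ = ⊥-elim (<-asym u<z z<u)
    uncrossed∈interior {z = z} (_∷_ {v = a} s q) u<z z<w uncrossed with <-cmp a z
    ... | tri< a<z _ _  = interior-cons s q (uncrossed∈interior q a<z z<w uncrossed)
    ... | tri≈ _ refl _ = interior-head s q (<⇒≢ z<w)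
    ... | tri> _ _ z<a  = ⊥-elim (uncrossed (step-across⇒crossed s u<z z<a))

    twoDisjointPaths⇒covers : ∀ {s} → TwoDisjointPaths n E G s n → Covers G (suc s)
    twoDisjointPaths⇒covers (p , q , _ , _ , _ , disjoint) {z} s<z z<n
      with any? (crossesIn? G z)
    ... | yes crossed = crossed
    ... | no uncrossed = ⊥-elim (disjoint z (uncrossed∈interior p s<z z<n uncrossed)
                                            (uncrossed∈interior q s<z z<n uncrossed))

    jump-isPath : ∀ {e w} (e∈ : e ∈ G) {q : Walk n E G (Y e) w} →
                  (∀ {x} → x ∈ₗ vertices q → Y e ≤ x) → IsPath q → IsPath (fwdE e e∈ ∷ q)
    jump-isPath {e} e∈ above q-path =
      step-isPath (fwdE e e∈) (λ x∈ → <⇒≢ (<-≤-trans (X<Y e) (above x∈))) q-path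

    record DisjointRoutes (a b : ℕ) : Set where
      field
        left        : Walk n E G a n
        right       : Walk n E G b n
        left-path   : IsPath left
        right-path  : IsPath right
        left-above  : ∀ {x} → x ∈ₗ vertices left → a ≤ x
        right-above : ∀ {x} → x ∈ₗ vertices right → b ≤ x
        meet-at-end : ∀ {x} → x ∈ₗ vertices left → x ∈ₗ vertices right → x ≡ n

    routesToEnd : ∀ {v} → v ≤ n → DisjointRoutes v n
    routesToEnd v≤n = record
      { left        = ascend v≤‴n ≤-refl []
      ; right       = []
      ; left-path   = ascend-isPath v≤‴n ≤-refl (λ { (here refl) → ≤-refl }) (All.[] ∷ [])
      ; right-path  = All.[] ∷ []
      ; left-above  = λ x∈ → [ proj₁ , (λ { (here refl) → v≤n }) ]′ (ascend-vertices v≤‴n ≤-refl [] x∈)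
      ; right-above = λ { (here refl) → ≤-refl }
      ; meet-at-end = λ _ → λ { (here refl) → refl }
      }
      where
      v≤‴n = ≤⇒≤‴ v≤n

    -- The routes swap sides: the new left route climbs to e and jumps onto
    -- the old right route.
    extendRoutes : ∀ {u v e} → e ∈ G → u ≤ X e → X e < v → DisjointRoutes v (Y e) → DisjointRoutes u v
    extendRoutes {u} {v} {e} e∈ u≤X X<v R = record
      { left        = ascend u≤‴X X≤n jump
      ; right       = left
      ; left-path   = ascend-isPath u≤‴X X≤n jump-above (jump-isPath e∈ right-above right-path)
      ; right-path  = left-path
      ; left-above  = λ x∈ → [ proj₁ , (λ x∈jump → ≤-trans u≤X (jump-above x∈jump)) ]′
                               (ascend-vertices u≤‴X X≤n jump x∈)
      ; right-above = left-above
      ; meet-at-end = meet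
      }
      where
      open DisjointRoutes R
      u≤‴X = ≤⇒≤‴ u≤X
      X≤n = <⇒≤ (<-≤-trans (X<Y e) (Y≤n e))
      jump : Walk n E G (X e) n
      jump = fwdE e e∈ ∷ right
      jump-above : ∀ {x} → x ∈ₗ vertices jump → X e ≤ x
      jump-above (here refl) = ≤-refl
      jump-above (there x∈)  = <⇒≤ (<-≤-trans (X<Y e) (right-above x∈))
      meet : ∀ {x} → x ∈ₗ vertices (ascend u≤‴X X≤n jump) → x ∈ₗ vertices left → x ≡ n
      meet x∈new x∈left with ascend-vertices u≤‴X X≤n jump x∈new
      ... | inj₁ (_ , x<X)       = ⊥-elim (<-asym x<X (<-≤-trans X<v (left-above x∈left)))
      ... | inj₂ (here refl)     = ⊥-elim (<-irrefl refl (<-≤-trans X<v (left-above x∈left)))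
      ... | inj₂ (there x∈right) = meet-at-end x∈left x∈right

    routesFromCover : ∀ {v w} → Acc _<_ (n ∸ w) → v ≤ w → w ≤ n → Covers G w →
                      (∀ f → CrossesIn G w f → v ≤ X f) → DisjointRoutes v w
    routesFromCover (acc smaller) v≤w w≤n covers starts-after with m≤n⇒m<n∨m≡n w≤n
    ... | inj₂ refl = routesToEnd v≤w
    ... | inj₁ w<n with outermost (covers ≤-refl w<n)
    ...   | e , out@(e-crosses@(e∈ , X<w , w<Y) , _) =
      extendRoutes e∈ (starts-after e e-crosses) X<w
        (routesFromCover (smaller (∸-monoʳ-< w<Y (Y≤n e))) (<⇒≤ w<Y) (Y≤n e)
          (λ Y≤z → covers (≤-trans (<⇒≤ w<Y) Y≤z)) (λ f → outermost-beyond out ≤-refl))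

    covers⇒twoDisjointPaths : ∀ {s} → suc s < n → Covers G (suc s) → TwoDisjointPaths n E G s n
    covers⇒twoDisjointPaths {s} s<n covers with outermost (covers ≤-refl s<n)
    ... | e , out@((e∈ , s≤s X≤s , s<Y) , _) =
      upper , lower , upper-path , lower-path , labels≢ , disjoint
      where
      R : DisjointRoutes (suc s) (Y e)
      R = routesFromCover (<-wellFounded _) (<⇒≤ s<Y) (Y≤n e)
            (λ Y≤z → covers (≤-trans (<⇒≤ s<Y) Y≤z)) (λ f → outermost-beyond out ≤-refl)
      open DisjointRoutes R
      X≤′s = ≤⇒≤′ X≤s
      s<n′ = <-trans (n<1+n s) s<n
      s≤n = <⇒≤ s<n′
      up = fwdP s s<n′
      upper = up ∷ left
      lower = descend X≤′s s≤n (fwdE e e∈ ∷ right)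
      upper-path : IsPath upper
      upper-path = step-isPath up (λ x∈ → <⇒≢ (left-above x∈)) left-path
      lower-path : IsPath lower
      lower-path = descend-isPath X≤′s s≤n outside (jump-isPath e∈ right-above right-path)
        where
        outside : ∀ {x} → x ∈ₗ vertices (fwdE e e∈ ∷ right) → x ≤ X e ⊎ s < x
        outside (here refl) = inj₁ ≤-refl
        outside (there x∈)  = inj₂ (<-trans (n<1+n s) (<-≤-trans s<Y (right-above x∈)))
      labels≢ : labels upper ≢ labels lower
      labels≢ eq = labels-descend-jump≢pathEdge X≤′s s≤n e∈ right (labels left) (sym eq)
      disjoint : ∀ x → x ∈ₗ interior upper → ¬ (x ∈ₗ interior lower)
      disjoint x x∈upper x∈lower
        with interior⊆tail up left x∈upper | descend-vertices X≤′s s≤n _ (interior⊆vertices lower x∈lower)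
      ... | x∈left | inj₁ (_ , x≤s)       = <⇒≱ (left-above x∈left) x≤s
      ... | x∈left | inj₂ (here refl)     = <⇒≱ (left-above x∈left) X≤s
      ... | x∈left | inj₂ (there x∈right) =
        interior-≢-end upper upper-path x∈upper (meet-at-end x∈left x∈right)

    twoDisjointPaths⇔covers : ∀ {s} → suc s < n → TwoDisjointPaths n E G s n ⇔ Covers G (suc s)
    twoDisjointPaths⇔covers s<n = mk⇔ twoDisjointPaths⇒covers (covers⇒twoDisjointPaths s<n)

  above : ℕ → Subset m
  above j = tabulate (λ f → j ≤ᵇ X f)

  ∈-above⁻ : ∀ {j f} → f ∈ above j → j ≤ X f
  ∈-above⁻ {j} {f} f∈ =
    ≤ᵇ⇒≤ j (X f) (Equivalence.from T-≡ (trans (sym (lookup∘tabulate _ f)) ([]=⇒lookup f∈)))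

  ∈-above⁺ : ∀ {j f} → j ≤ X f → f ∈ above j
  ∈-above⁺ {j} {f} j≤X = lookup⇒[]= f _ (trans (lookup∘tabulate _ f) (Equivalence.to T-≡ (≤⇒≤ᵇ j≤X)))

  ⁅⁆-⊆ : ∀ {e : Fin m} {F} → e ∈ F → ⁅ e ⁆ ⊆ F
  ⁅⁆-⊆ {e} e∈F x∈e = subst (_∈ _) (sym (x∈⁅y⁆⇒x≡y e x∈e)) e∈F

  ⁅⁆∪-⊆ : ∀ {e : Fin m} {H F} → e ∈ F → H ⊆ F → ⁅ e ⁆ ∪ H ⊆ F
  ⁅⁆∪-⊆ {e} {H} e∈F H⊆F x∈ with x∈p∪q⁻ ⁅ e ⁆ H x∈
  ... | inj₁ x∈e = ⁅⁆-⊆ e∈F x∈e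
  ... | inj₂ x∈H = H⊆F x∈H

  covers-⁅⁆ : ∀ {e j} → X e < j → Y e ≡ n → Covers ⁅ e ⁆ j
  covers-⁅⁆ {e} X<j refl j≤z z<n = e , x∈⁅x⁆ e , <-≤-trans X<j j≤z , z<n

  covers-⁅⁆∪ : ∀ {e j H} → X e < j → Covers H (Y e) → Covers (⁅ e ⁆ ∪ H) j
  covers-⁅⁆∪ {e} {j} {H} X<j covers {z} j≤z z<n with z <? Y e
  ... | yes z<Y = e , x∈p∪q⁺ (inj₁ (x∈⁅x⁆ e)) , <-≤-trans X<j j≤z , z<Y
  ... | no z≮Y with covers (≮⇒≥ z≮Y) z<n
  ...   | f , f∈H , f-crosses = f , x∈p∪q⁺ (inj₂ f∈H) , f-crosses

  crossing-forced : ∀ {G e j} → j < n → Covers G j → (∀ f → CrossesIn G j f → f ≡ e) → e ∈ G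
  crossing-forced j<n covers only-e with covers ≤-refl j<n
  ... | f , f-crosses@(f∈ , _) = subst (_∈ _) (only-e f f-crosses) f∈

  MinimalCover : ℕ → ℕ → Subset m → Set
  MinimalCover i j F =
    (Covers F j × (∀ G → G ⊆ F → Covers G j → G ≡ F)) × (∀ e → e ∈ F → i ≤ X e)

  inFam⇔minimalCover : ∀ {i j F} → 0 < j → j < n → InFam n E i j F ⇔ MinimalCover i j F
  inFam⇔minimalCover {j = suc s} _ s<n = mk⇔
    (Product.map₁ (Product.map (to tdp⇔) (λ minimal G G⊆F → minimal G G⊆F ∘ from tdp⇔)))
    (Product.map₁ (Product.map (from tdp⇔) (λ minimal G G⊆F → minimal G G⊆F ∘ to tdp⇔)))
    where
    open Equivalence
    tdp⇔ : ∀ {G} → TwoDisjointPaths n E G s n ⇔ Covers G (suc s)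
    tdp⇔ = twoDisjointPaths⇔covers s<n

  Single : ℕ → Subset m → Set
  Single x F = ∃ λ e → E e ≡ (x , n) × F ≡ ⁅ e ⁆

  Extension : ℕ → ℕ → ℕ → Subset m → Set
  Extension i j x F = ∃ λ e → ∃ λ y → Σ (Subset m) λ F′ →
    E e ≡ (x , y) × i ≤ x × x < j × j < y × y < n × InFam n E j y F′ × F ≡ ⁅ e ⁆ ∪ F′

  single-extension-exclusive : ∀ {i j x F} → ¬ (Single x F × Extension i j x F)
  single-extension-exclusive ((e , E≡xn , refl) , (e′ , y , F′ , E≡xy , _ , _ , _ , y<n , _ , F≡))
    with x∈⁅y⁆⇒x≡y e (subst (e′ ∈_) (sym F≡) (x∈p∪q⁺ (inj₁ (x∈⁅x⁆ e′))))
  ... | refl = <-irrefl (cong proj₂ (trans (sym E≡xy) E≡xn)) y<n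

  outermost-split : ∀ {i j F e} → MinimalCover i j F → Outermost F j e → Y e < n →
                    MinimalCover j (Y e) (F ∩ above j) × F ≡ ⁅ e ⁆ ∪ (F ∩ above j)
  outermost-split {i} {j} {F} {e} ((covers , minimal) , _) out@((e∈ , X<j , j<Y) , _) Y<n =
    ((covers′ , minimal′) , λ f f∈ → ∈-above⁻ (proj₂ (x∈p∩q⁻ F _ f∈))) , sym (glue ⊆-refl covers′)
    where
    F′ = F ∩ above j
    covers′ : Covers F′ (Y e)
    covers′ Y≤z z<n with covers (≤-trans (<⇒≤ j<Y) Y≤z) z<n
    ... | f , f-crosses@(f∈ , _) =
      f , x∈p∩q⁺ (f∈ , ∈-above⁺ (outermost-beyond out Y≤z f-crosses)) , proj₂ f-crosses
    glue : ∀ {H} → H ⊆ F′ → Covers H (Y e) → ⁅ e ⁆ ∪ H ≡ F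
    glue H⊆F′ coversH = minimal _ (⁅⁆∪-⊆ e∈ (⊆-trans H⊆F′ (p∩q⊆p F _))) (covers-⁅⁆∪ X<j coversH)
    minimal′ : ∀ H → H ⊆ F′ → Covers H (Y e) → H ≡ F′
    minimal′ H H⊆F′ coversH = ⊆-antisym H⊆F′ F′⊆H
      where
      F′⊆H : F′ ⊆ H
      F′⊆H {f} f∈F′ with x∈p∪q⁻ ⁅ e ⁆ H (subst (f ∈_) (sym (glue H⊆F′ coversH)) (p∩q⊆p F _ f∈F′))
      ... | inj₂ f∈H = f∈H
      ... | inj₁ f∈e with x∈⁅y⁆⇒x≡y e f∈e
      ...   | refl = ⊥-elim (<⇒≱ X<j (∈-above⁻ (proj₂ (x∈p∩q⁻ F _ f∈F′))))

  minimalCover⇒options : ∀ {i j F} → j < n → MinimalCover i j F →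
                         ∃ λ x → i ≤ x × x < j × ExactlyOne (Single x F) (Extension i j x F)
  minimalCover⇒options {i} {j} {F} j<n cover@((covers , minimal) , starts-after)
    with outermost (covers ≤-refl j<n)
  ... | e , out@((e∈ , X<j , j<Y) , _) =
    X e , i≤X , X<j , option (m≤n⇒m<n∨m≡n (Y≤n e)) , single-extension-exclusive
    where
    i≤X = starts-after e e∈
    option : Y e < n ⊎ Y e ≡ n → Single (X e) F ⊎ Extension i j (X e) F
    option (inj₂ Y≡n) = inj₁ (e , cong (X e ,_) Y≡n ,
                              sym (minimal ⁅ e ⁆ (⁅⁆-⊆ e∈) (covers-⁅⁆ X<j Y≡n)))
    option (inj₁ Y<n) with outermost-split cover out Y<n
    ... | rest , F≡ = inj₂ (e , Y e , _ , refl , i≤X , X<j , j<Y , Y<n ,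
                            Equivalence.from (inFam⇔minimalCover (≤-<-trans z≤n j<Y) Y<n) rest , F≡)

  single⇒minimalCover : ∀ {i j x F} → i ≤ x → x < j → j < n → Single x F → MinimalCover i j F
  single⇒minimalCover {i} {j} i≤x x<j j<n (e , E≡xn , refl) =
    (covers-⁅⁆ (subst (_< j) (sym X≡x) x<j) (cong proj₂ E≡xn) , minimal) , starts-after
    where
    X≡x = cong proj₁ E≡xn
    minimal : ∀ G → G ⊆ ⁅ e ⁆ → Covers G j → G ≡ ⁅ e ⁆
    minimal G G⊆e coversG =
      ⊆-antisym G⊆e (⁅⁆-⊆ (crossing-forced j<n coversG λ f (f∈ , _) → x∈⁅y⁆⇒x≡y e (G⊆e f∈)))
    starts-after : ∀ f → f ∈ ⁅ e ⁆ → i ≤ X f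
    starts-after f f∈ rewrite x∈⁅y⁆⇒x≡y e f∈ = subst (i ≤_) (sym X≡x) i≤x

  extension⇒minimalCover : ∀ {i j x F} → i < j → j < n → Extension i j x F → MinimalCover i j F
  extension⇒minimalCover {i} {j} i<j j<n (e , y , F′ , E≡xy , i≤x , x<j , j<y , y<n , inFam , refl)
    with Equivalence.to (inFam⇔minimalCover (≤-<-trans z≤n j<y) y<n) inFam
  ... | (coversF′ , minimalF′) , startsF′ =
    (covers-⁅⁆∪ X<j (subst (Covers F′) (sym Y≡y) coversF′) , minimal) , starts-after
    where
    X≡x = cong proj₁ E≡xy
    Y≡y = cong proj₂ E≡xy
    X<j = subst (_< j) (sym X≡x) x<j
    minimal : ∀ G → G ⊆ ⁅ e ⁆ ∪ F′ → Covers G j → G ≡ ⁅ e ⁆ ∪ F′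
    minimal G G⊆ coversG = ⊆-antisym G⊆ (⁅⁆∪-⊆ e∈G F′⊆G)
      where
      coversG∩F′ : Covers (G ∩ F′) y
      coversG∩F′ y≤z z<n with coversG (≤-trans (<⇒≤ j<y) y≤z) z<n
      ... | g , g∈G , g-crosses with x∈p∪q⁻ ⁅ e ⁆ F′ (G⊆ g∈G)
      ...   | inj₂ g∈F′ = g , x∈p∩q⁺ (g∈G , g∈F′) , g-crosses
      ...   | inj₁ g∈e with x∈⁅y⁆⇒x≡y e g∈e
      ...     | refl = ⊥-elim (<⇒≱ (proj₂ g-crosses) (subst (_≤ _) (sym Y≡y) y≤z))
      F′⊆G : F′ ⊆ G
      F′⊆G f∈ = p∩q⊆p G F′ (subst (_ ∈_) (sym (minimalF′ (G ∩ F′) (p∩q⊆q G F′) coversG∩F′)) f∈)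
      only-e : ∀ g → CrossesIn G j g → g ≡ e
      only-e g (g∈G , Xg<j , _) with x∈p∪q⁻ ⁅ e ⁆ F′ (G⊆ g∈G)
      ... | inj₁ g∈e  = x∈⁅y⁆⇒x≡y e g∈e
      ... | inj₂ g∈F′ = ⊥-elim (<⇒≱ Xg<j (startsF′ g g∈F′))
      e∈G : e ∈ G
      e∈G = crossing-forced j<n coversG only-e
    starts-after : ∀ f → f ∈ ⁅ e ⁆ ∪ F′ → i ≤ X f
    starts-after f f∈ with x∈p∪q⁻ ⁅ e ⁆ F′ f∈
    ... | inj₁ f∈e rewrite x∈⁅y⁆⇒x≡y e f∈e = subst (i ≤_) (sym X≡x) i≤x
    ... | inj₂ f∈F′ = ≤-trans (<⇒≤ i<j) (startsF′ f f∈F′)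

lemma3 : (n : ℕ) → 2 ≤ n → {m : ℕ} → (E : Fin m → ℕ × ℕ) → ValidEdges n E →
         (i j : ℕ) → i < j → j < n → (F : Subset m) →
         InFam n E i j F ⇔
           (∃ λ x → i ≤ x × x < j ×
             ExactlyOne
               (∃ λ e → E e ≡ (x , n) × F ≡ ⁅ e ⁆)
               (∃ λ e → ∃ λ y → Σ (Subset m) λ F′ →
                  E e ≡ (x , y) × i ≤ x × x < j × j < y × y < n ×
                  InFam n E j y F′ × F ≡ ⁅ e ⁆ ∪ F′))
-- The hypothesis 2 ≤ n is implied by i < j < n.
lemma3 n _ E valid i j i<j j<n F = mk⇔
  (minimalCover⇒options j<n ∘ Equivalence.to inFam⇔)
  (λ { (x , i≤x , x<j , option , _) → Equivalence.from inFam⇔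
         ([ single⇒minimalCover i≤x x<j j<n , extension⇒minimalCover i<j j<n ]′ option) })
  where
  open Covering n E valid
  inFam⇔ : InFam n E i j F ⇔ MinimalCover i j F
  inFam⇔ = inFam⇔minimalCover (≤-<-trans z≤n i<j) j<n
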